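{- Let $\mathsf H$ be any of the hypersequent calculi $\mathsf{H.N},\mathsf{H.NN},\mathsf{H.NT},\mathsf{H.NW},\mathsf{H.NC},\mathsf{H.NA},\mathsf{H.NNA}$. Then all the rules of $\mathsf H$ are height-preserving invertible, and the following rules are height-preserving admissible in $\mathsf H$ (where in $\mathrm{wk}_R$ and $\mathrm{ctr}_R$, $A$ may be a formula or a block): $\mathrm{wk}_L$: from $\mathcal G\mid\Gamma\Rightarrow\Delta$ infer $\mathcal G\mid A,\Gamma\Rightarrow\Delta$; $\mathrm{wk}_R$: from $\mathcal G\mid\Gamma\Rightarrow\Delta$ infer $\mathcal G\mid\Gamma\Rightarrow\Delta,A$; $\mathrm{wk}_C$: from $\mathcal G$ infer $\mathcal G\mid\mathcal H$; $\mathrm{wk}_B$: from $\mathcal G\mid\Gamma\Rightarrow\Delta,[\Sigma\lhd A]$ infer $\mathcal G\mid\Gamma\Rightarrow\Delta,[\Sigma,B\lhd A]$; $\mathrm{ctr}_L$: from $\mathcal G\mid A,A,\Gamma\Rightarrow\Delta$ infer $\mathcal G\mid A,\Gamma\Rightarrow\Delta$; $\mathrm{ctr}_R$: from $\mathcal G\mid\Gamma\Rightarrow\Delta,A,A$ infer $\mathcal G\mid\Gamma\Rightarrow\Delta,A$; $\mathrm{ctr}_C$: from $\mathcal G\mid\mathcal H\mid\mathcal H$ infer $\mathcal G\mid\mathcal H$; $\mathrm{ctr}_B$: from $\mathcal G\mid\Gamma\Rightarrow\Delta,[\Sigma,B,B\lhd A]$ infer $\mathcal G\mid\Gamma\Rightarrow\Delta,[\Sigma,B\lhd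 A]$.
   Context: Language: formulas $A ::= p \mid \bot \mid A\to A \mid A \preccurlyeq A$ over countably many atoms; $\top$ defined as usual. Hypersequents: a block $[\Sigma\lhd A]$ consists of a finite multiset $\Sigma$ of formulas and a formula $A$; a sequent with blocks $\Gamma\Rightarrow\Delta$ has $\Gamma$ a finite multiset of formulas and $\Delta$ a finite multiset of formulas and blocks; a hypersequent is a finite multiset $\Gamma_1\Rightarrow\Delta_1\mid\dots\mid\Gamma_n\Rightarrow\Delta_n$ of sequents with blocks (components); $\mathcal H$ denotes a sequent with blocks and $\mathcal G$ a (possibly empty) hypersequent. Rules: init: $\mathcal G\mid\Gamma,p\Rightarrow p,\Delta$; $\bot_L$: $\mathcal G\mid\Gamma,\bot\Rightarrow\Delta$; $\to_L$: from $\mathcal G\mid\Gamma,A\to B,B\Rightarrow\Delta$ and $\mathcal G\mid\Gamma,A\to B\Rightarrow\Delta,A$ infer $\mathcal G\mid\Gamma,A\to B\Rightarrow\Delta$; $\to_R$: from $\mathcal G\mid\Gamma,A\Rightarrow\Delta,A\to B,B$ infer $\mathcal G\mid\Gamma\Rightarrow\Delta,A\to B$; $\preccurlyeq_L$: from $\mathcal G\mid\Gamma,A\preccurlyeq B\Rightarrow\Delta,[B,\Sigma\lhd C]$ and $\mathcal G\mid\Gamma,A\preccurlyeq B\Rightarrow\Delta,[\Sigma\lhd C],[\Sigma\lhd A]$ infer $\mathcal G\mid\Gamma,A\preccurlyeq B\Rightarrow\Delta,[\Sigma\lhd C]$; $\preccurlyeq_R$: from $\mathcal G\mid\Gamma\Rightarrow\Delta,A\preccurlyeq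 B,[A\lhd B]$ infer $\mathcal G\mid\Gamma\Rightarrow\Delta,A\preccurlyeq B$; jp: from $\mathcal G\mid\Gamma\Rightarrow\Delta,[\Sigma\lhd A]\mid A\Rightarrow\Sigma$ infer $\mathcal G\mid\Gamma\Rightarrow\Delta,[\Sigma\lhd A]$; N: from $\mathcal G\mid\Gamma\Rightarrow\Delta,[\bot\lhd\top]$ infer $\mathcal G\mid\Gamma\Rightarrow\Delta$; T: from $\mathcal G\mid\Gamma,A\preccurlyeq B\Rightarrow\Delta,B$ and $\mathcal G\mid\Gamma,A\preccurlyeq B\Rightarrow\Delta,[\bot\lhd A]$ infer $\mathcal G\mid\Gamma,A\preccurlyeq B\Rightarrow\Delta$; W: from $\mathcal G\mid\Gamma\Rightarrow\Delta,[\Sigma\lhd A],\Sigma$ infer $\mathcal G\mid\Gamma\Rightarrow\Delta,[\Sigma\lhd A]$; C: from $\mathcal G\mid\Gamma,A\preccurlyeq B\Rightarrow\Delta,B$ and $\mathcal G\mid\Gamma,A\preccurlyeq B,A\Rightarrow\Delta$ infer $\mathcal G\mid\Gamma,A\preccurlyeq B\Rightarrow\Delta$; $\mathrm A_L$: from $\mathcal G\mid\Gamma,A\preccurlyeq B\Rightarrow\Delta\mid\Omega,A\preccurlyeq B\Rightarrow\Theta$ infer $\mathcal G\mid\Gamma,A\preccurlyeq B\Rightarrow\Delta\mid\Omega\Rightarrow\Theta$; $\mathrm A_R$: from $\mathcal G\mid\Gamma\Rightarrow\Delta,A\preccurlyeq B\mid\Omega\Rightarrow\Theta,A\preccurlyeq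 B$ infer $\mathcal G\mid\Gamma\Rightarrow\Delta,A\preccurlyeq B\mid\Omega\Rightarrow\Theta$. Calculi: $\mathsf{H.N}=\{\mathrm{init},\bot_L,\to_L,\to_R,\preccurlyeq_L,\preccurlyeq_R,\mathrm{jp}\}$; $\mathsf{H.NN}=\mathsf{H.N}+$N; $\mathsf{H.NT}=\mathsf{H.N}+$T; $\mathsf{H.NW}=\mathsf{H.N}+$T,W; $\mathsf{H.NC}=\mathsf{H.N}+$W,C; $\mathsf{H.NA}=\mathsf{H.N}+\mathrm A_L,\mathrm A_R$; $\mathsf{H.NNA}=\mathsf{H.NN}+\mathrm A_L,\mathrm A_R$. A rule is height-preserving invertible if whenever its conclusion is derivable, each premiss is derivable with a derivation of at most the same height; height-preserving admissible if whenever its premiss is derivable, its conclusion is derivable with at most the same height. -}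

module Defs where

open import Data.Nat using (ℕ; suc)
open import Data.List using (List; []; _∷_; _++_; map)
open import Data.List.Relation.Unary.All using (All)
open import Data.List.Relation.Binary.Permutation.Propositional using (_↭_)
open import Data.List.Relation.Binary.Permutation.Homogeneous using (Permutation)
open import Relation.Binary.PropositionalEquality using (_≡_)
import Data.Unit as U
import Data.Empty as E
open import Data.Product using (_×_)

infixr 30 _⊃_
infix 35 _≼_

data Fm : Set where
  atom : ℕ → Fm
  bot  : Fm
  _⊃_  : Fm → Fm → Fm
  _≼_  : Fm → Fm → Fm

top : Fm
top = bot ⊃ bot

data Item : Set where
  fm  : Fm → Item
  blk : List Fm → Fm → Item     -- blk Σ A  is the block [Σ ◁ A]

infix 4 _⇒_
record Seq : Set where
  constructor _⇒_
  field
    ante : List Fm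
    succ : List Item

Hyp : Set
Hyp = List Seq

-- Multiset equality (lists up to permutation, nested)

data _≈I_ : Item → Item → Set where
  fm≈  : ∀ {A} → fm A ≈I fm A
  blk≈ : ∀ {Σ Σ′ A} → Σ ↭ Σ′ → blk Σ A ≈I blk Σ′ A

_≈S_ : Seq → Seq → Set
(Γ ⇒ Δ) ≈S (Γ′ ⇒ Δ′) = (Γ ↭ Γ′) × Permutation _≈I_ Δ Δ′

_≈H_ : Hyp → Hyp → Set
_≈H_ = Permutation _≈S_

data Calc : Set where
  HN HNN HNT HNW HNC HNA HNNA : Calc

HasN : Calc → Set
HasN HNN  = U.⊤
HasN HNNA = U.⊤
HasN _    = E.⊥

HasT : Calc → Set
HasT HNT = U.⊤
HasT HNW = U.⊤
HasT _   = E.⊥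

HasW : Calc → Set
HasW HNW = U.⊤
HasW HNC = U.⊤
HasW _   = E.⊥

HasC : Calc → Set
HasC HNC = U.⊤
HasC _   = E.⊥

HasA : Calc → Set
HasA HNA  = U.⊤
HasA HNNA = U.⊤
HasA _    = E.⊥

-- Rule c ps C : (ps / C) is an instance of a rule of calculus c,
-- with premisses ps and conclusion C.  In G | H the context G is the tail.
data Rule (c : Calc) : List Hyp → Hyp → Set where
  init : ∀ {G Γ Δ p} →
    Rule c [] ((atom p ∷ Γ ⇒ fm (atom p) ∷ Δ) ∷ G)
  botL : ∀ {G Γ Δ} →
    Rule c [] ((bot ∷ Γ ⇒ Δ) ∷ G)
  impL : ∀ {G Γ Δ A B} →
    Rule c ((((A ⊃ B) ∷ B ∷ Γ ⇒ Δ) ∷ G)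
           ∷ (((A ⊃ B) ∷ Γ ⇒ fm A ∷ Δ) ∷ G) ∷ [])
           (((A ⊃ B) ∷ Γ ⇒ Δ) ∷ G)
  impR : ∀ {G Γ Δ A B} →
    Rule c (((A ∷ Γ ⇒ fm (A ⊃ B) ∷ fm B ∷ Δ) ∷ G) ∷ [])
           ((Γ ⇒ fm (A ⊃ B) ∷ Δ) ∷ G)
  precL : ∀ {G Γ Δ Σ A B C} →
    Rule c ((((A ≼ B) ∷ Γ ⇒ blk (B ∷ Σ) C ∷ Δ) ∷ G)
           ∷ (((A ≼ B) ∷ Γ ⇒ blk Σ C ∷ blk Σ A ∷ Δ) ∷ G) ∷ [])
           (((A ≼ B) ∷ Γ ⇒ blk Σ C ∷ Δ) ∷ G)
  precR : ∀ {G Γ Δ A B} →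
    Rule c (((Γ ⇒ fm (A ≼ B) ∷ blk (A ∷ []) B ∷ Δ) ∷ G) ∷ [])
           ((Γ ⇒ fm (A ≼ B) ∷ Δ) ∷ G)
  jp : ∀ {G Γ Δ Σ A} →
    Rule c (((Γ ⇒ blk Σ A ∷ Δ) ∷ (A ∷ [] ⇒ map fm Σ) ∷ G) ∷ [])
           ((Γ ⇒ blk Σ A ∷ Δ) ∷ G)
  ruleN : ∀ {G Γ Δ} → HasN c →
    Rule c (((Γ ⇒ blk (bot ∷ []) top ∷ Δ) ∷ G) ∷ [])
           ((Γ ⇒ Δ) ∷ G)
  ruleT : ∀ {G Γ Δ A B} → HasT c →
    Rule c ((((A ≼ B) ∷ Γ ⇒ fm B ∷ Δ) ∷ G)
           ∷ (((A ≼ B) ∷ Γ ⇒ blk (bot ∷ []) A ∷ Δ) ∷ G) ∷ [])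
           (((A ≼ B) ∷ Γ ⇒ Δ) ∷ G)
  ruleW : ∀ {G Γ Δ Σ A} → HasW c →
    Rule c (((Γ ⇒ blk Σ A ∷ (map fm Σ ++ Δ)) ∷ G) ∷ [])
           ((Γ ⇒ blk Σ A ∷ Δ) ∷ G)
  ruleC : ∀ {G Γ Δ A B} → HasC c →
    Rule c ((((A ≼ B) ∷ Γ ⇒ fm B ∷ Δ) ∷ G)
           ∷ (((A ≼ B) ∷ A ∷ Γ ⇒ Δ) ∷ G) ∷ [])
           (((A ≼ B) ∷ Γ ⇒ Δ) ∷ G)
  ruleAL : ∀ {G Γ Δ Ω Θ A B} → HasA c →
    Rule c ((((A ≼ B) ∷ Γ ⇒ Δ) ∷ ((A ≼ B) ∷ Ω ⇒ Θ) ∷ G) ∷ [])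
           (((A ≼ B) ∷ Γ ⇒ Δ) ∷ (Ω ⇒ Θ) ∷ G)
  ruleAR : ∀ {G Γ Δ Ω Θ A B} → HasA c →
    Rule c (((Γ ⇒ fm (A ≼ B) ∷ Δ) ∷ (Ω ⇒ fm (A ≼ B) ∷ Θ) ∷ G) ∷ [])
           ((Γ ⇒ fm (A ≼ B) ∷ Δ) ∷ (Ω ⇒ Θ) ∷ G)

-- Der c n H : H has a derivation in calculus c of height at most n
-- (a leaf has height 1; each rule application adds 1).  Rule instances are
-- applied up to multiset equality of the hypersequent.
data Der (c : Calc) : ℕ → Hyp → Set where
  der : ∀ {n ps C H} → Rule c ps C → H ≈H C → All (Der c n) ps →
        Der c (suc n) H

AllRulesHPInvertible : Calc → Set
AllRulesHPInvertible c =
  ∀ {ps C} → Rule c ps C → ∀ n → Der c n C → All (Der c n) ps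

HPAdmissible : Calc → (Hyp → Hyp → Set) → Set
HPAdmissible c R = ∀ {P C} → R P C → ∀ n → Der c n P → Der c n C

data WkL : Hyp → Hyp → Set where
  wkL : ∀ {G Γ Δ A} → WkL ((Γ ⇒ Δ) ∷ G) ((A ∷ Γ ⇒ Δ) ∷ G)

data WkR : Hyp → Hyp → Set where
  wkR : ∀ {G Γ Δ} {A : Item} → WkR ((Γ ⇒ Δ) ∷ G) ((Γ ⇒ A ∷ Δ) ∷ G)

data WkC : Hyp → Hyp → Set where
  wkC : ∀ {G} {H : Seq} → WkC G (H ∷ G)

data WkB : Hyp → Hyp → Set where
  wkB : ∀ {G Γ Δ Σ A B} →
    WkB ((Γ ⇒ blk Σ A ∷ Δ) ∷ G) ((Γ ⇒ blk (B ∷ Σ) A ∷ Δ) ∷ G)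

data CtrL : Hyp → Hyp → Set where
  ctrL : ∀ {G Γ Δ A} → CtrL ((A ∷ A ∷ Γ ⇒ Δ) ∷ G) ((A ∷ Γ ⇒ Δ) ∷ G)

data CtrR : Hyp → Hyp → Set where
  ctrR : ∀ {G Γ Δ} {A : Item} → CtrR ((Γ ⇒ A ∷ A ∷ Δ) ∷ G) ((Γ ⇒ A ∷ Δ) ∷ G)

data CtrC : Hyp → Hyp → Set where
  ctrC : ∀ {G} {H : Seq} → CtrC (H ∷ H ∷ G) (H ∷ G)

data CtrB : Hyp → Hyp → Set where
  ctrB : ∀ {G Γ Δ Σ A B} →
    CtrB ((Γ ⇒ blk (B ∷ B ∷ Σ) A ∷ Δ) ∷ G) ((Γ ⇒ blk (B ∷ Σ) A ∷ Δ) ∷ G)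

{-# OPTIONS --safe #-}
module Submission where

-- Compare hypersequents by covering: H ⊑ H′ when every component of H is included, as a
-- pair of sets, in some component of H′, a block [Σ ◁ A] being included in [Σ′ ◁ A] when
-- Σ ⊆ Σ′.  This preorder ignores multiplicities, so it contains all the weakenings and
-- contractions; and since every premiss of every rule keeps its conclusion, each conclusion
-- is covered by each of its premisses.  Everything therefore follows from one fact: at
-- every height, derivability is upward closed under ⊑ (Der-resp-⊑).  By induction on the
-- height: the principal formulas of the last rule survive in the component covering the
-- principal component, so the same rule applies there and its premisses cover the old ones.
-- The exception is A_L/A_R when both active components are covered by a single component:
-- then the premiss itself is covered, and the smaller height leaves room to spare.

open import Defs
open import Data.Nat using (suc)
open import Data.Product using (_×_; _,_; proj₁; proj₂; ∃; ∃₂)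
open import Data.Sum using (_⊎_; inj₁; inj₂)
open import Function using (_∘_)
open import Data.List using (List; []; _∷_; _++_; map)
open import Data.List.Relation.Unary.All as All using (All; []; _∷_)
open import Data.List.Relation.Unary.Any as Any using (Any; here; there)
open import Data.List.Relation.Unary.Any.Properties using (++⁺ˡ; ++⁺ʳ; ++⁻)
open import Data.List.Membership.Propositional using (_∈_; find)
open import Data.List.Membership.Propositional.Properties using (∈-∃++; ∈-map⁺; ∈-map⁻)
open import Data.List.Relation.Binary.Subset.Propositional using (_⊆_)
open import Data.List.Relation.Binary.Permutation.Propositional
  using (_↭_; ↭-refl; ↭-sym; ↭⇒↭ₛ; prep; swap)
open import Data.List.Relation.Binary.Permutation.Propositional.Properties
  using (∈-resp-↭; shift)
open import Data.List.Relation.Binary.Permutation.Homogeneous as Perm using (Permutation)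
open import Data.List.Relation.Binary.Pointwise using (Pointwise; []; _∷_)
open import Relation.Binary.PropositionalEquality using (_≡_; refl; trans)

∈⇒↭ : ∀ {A : Set} {x : A} {xs} → x ∈ xs → ∃ λ ys → xs ↭ x ∷ ys
∈⇒↭ {x = x} x∈xs with ys , zs , refl ← ∈-∃++ x∈xs = ys ++ zs , shift x ys zs

module Cover {A : Set} (_≤_ : A → A → Set)
  (≤-refl : ∀ {x} → x ≤ x) (≤-trans : ∀ {x y z} → x ≤ y → y ≤ z → x ≤ z) where

  infix 4 _⊑_
  _⊑_ : List A → List A → Set
  xs ⊑ ys = ∀ {x} → x ∈ xs → Any (x ≤_) ys

  ⊑-refl : ∀ {xs} → xs ⊑ xs
  ⊑-refl = Any.map λ { refl → ≤-refl }

  ⊑-trans : ∀ {xs ys zs} → xs ⊑ ys → ys ⊑ zs → xs ⊑ zs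
  ⊑-trans xs⊑ys ys⊑zs x∈xs =
    let _ , y∈ys , x≤y = find (xs⊑ys x∈xs) in Any.map (≤-trans x≤y) (ys⊑zs y∈ys)

  ∷⁺ : ∀ {x y xs ys} → x ≤ y → xs ⊑ ys → x ∷ xs ⊑ y ∷ ys
  ∷⁺ x≤y xs⊑ys (here refl)  = here x≤y
  ∷⁺ x≤y xs⊑ys (there x∈xs) = there (xs⊑ys x∈xs)

  ∷⁺ˡ : ∀ {x y xs} → x ≤ y → x ∷ xs ⊑ y ∷ xs
  ∷⁺ˡ x≤y = ∷⁺ x≤y ⊑-refl

  ∈-∷⁺ʳ : ∀ {x xs ys} → Any (x ≤_) ys → xs ⊑ ys → x ∷ xs ⊑ ys
  ∈-∷⁺ʳ x≤ys xs⊑ys (here refl)  = x≤ys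
  ∈-∷⁺ʳ x≤ys xs⊑ys (there y∈xs) = xs⊑ys y∈xs

  xs⊑x∷xs : ∀ {x xs} → xs ⊑ x ∷ xs
  xs⊑x∷xs = there ∘ ⊑-refl

  x∷x∷xs⊑x∷xs : ∀ {x xs} → x ∷ x ∷ xs ⊑ x ∷ xs
  x∷x∷xs⊑x∷xs = ∈-∷⁺ʳ (here ≤-refl) ⊑-refl

  ++⁺ : ∀ {ws xs ys zs} → ws ⊑ xs → ys ⊑ zs → ws ++ ys ⊑ xs ++ zs
  ++⁺ {ws} {xs} ws⊑xs ys⊑zs v∈ with ++⁻ ws v∈
  ... | inj₁ v∈ws = ++⁺ˡ (ws⊑xs v∈ws)
  ... | inj₂ v∈ys = ++⁺ʳ xs (ys⊑zs v∈ys)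

  ↭⇒⊑ : ∀ {xs ys} → xs ↭ ys → xs ⊑ ys
  ↭⇒⊑ xs↭ys = ⊑-refl ∘ ∈-resp-↭ xs↭ys

  Pointwise⇒⊑ : ∀ {xs ys} → Pointwise _≤_ xs ys → xs ⊑ ys
  Pointwise⇒⊑ []           ()
  Pointwise⇒⊑ (x≤y ∷ xs≤ys) = ∷⁺ x≤y (Pointwise⇒⊑ xs≤ys)

  Permutation⇒⊑ : ∀ {xs ys} → Permutation _≤_ xs ys → xs ⊑ ys
  Permutation⇒⊑ (Perm.refl xs≤ys)  = Pointwise⇒⊑ xs≤ys
  Permutation⇒⊑ (Perm.prep x≤y p)  = ∷⁺ x≤y (Permutation⇒⊑ p)
  Permutation⇒⊑ (Perm.swap {x = x} {y} x≤x′ y≤y′ p) =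
    ⊑-trans (↭⇒⊑ (swap x y ↭-refl)) (∷⁺ y≤y′ (∷⁺ x≤x′ (Permutation⇒⊑ p)))
  Permutation⇒⊑ (Perm.trans p q)   = ⊑-trans (Permutation⇒⊑ p) (Permutation⇒⊑ q)

  ∷-++⁺ : ∀ {x y xs ys us vs} → x ∷ xs ⊑ y ∷ ys → us ⊑ vs → x ∷ us ++ xs ⊑ y ∷ vs ++ ys
  ∷-++⁺ {x} {y} {xs} {ys} {us} {vs} K us⊑vs =
    ⊑-trans (↭⇒⊑ (↭-sym (shift x us xs)))
      (⊑-trans (++⁺ us⊑vs K) (↭⇒⊑ (shift y vs ys)))

  ∷-∷⁺ : ∀ {x y u v xs ys} → x ∷ xs ⊑ y ∷ ys → u ≤ v → x ∷ u ∷ xs ⊑ y ∷ v ∷ ys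
  ∷-∷⁺ K u≤v = ∷-++⁺ K (∷⁺ u≤v λ ())

  x∷xs⊑x∷y∷xs : ∀ {x y xs} → x ∷ xs ⊑ x ∷ y ∷ xs
  x∷xs⊑x∷y∷xs {y = y} = ∷-++⁺ {us = []} {vs = y ∷ []} ⊑-refl λ ()

  replaceHead⁺ : ∀ {x x′ y y′ xs ys} → x ∷ xs ⊑ y ∷ ys → y ≤ y′ → x′ ≤ y′ → x′ ∷ xs ⊑ y′ ∷ ys
  replaceHead⁺ K y≤y′ x′≤y′ = ∈-∷⁺ʳ (here x′≤y′) (⊑-trans (K ∘ there) (∷⁺ˡ y≤y′))

-- For _≡_ the cover relation is definitionally _⊆_ on lists.
module F = Cover {Fm} _≡_ refl trans

infix 4 _≤I_ _≤S_ _⊑_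

data _≤I_ : Item → Item → Set where
  fm≤  : ∀ {A} → fm A ≤I fm A
  blk≤ : ∀ {Σ Σ′ A} → Σ ⊆ Σ′ → blk Σ A ≤I blk Σ′ A

≤I-refl : ∀ {x} → x ≤I x
≤I-refl {fm _}    = fm≤
≤I-refl {blk _ _} = blk≤ F.⊑-refl

≤I-trans : ∀ {x y z} → x ≤I y → y ≤I z → x ≤I z
≤I-trans fm≤       fm≤       = fm≤
≤I-trans (blk≤ p) (blk≤ q) = blk≤ (F.⊑-trans p q)

module I = Cover _≤I_ ≤I-refl ≤I-trans

_≤S_ : Seq → Seq → Set
(Γ ⇒ Δ) ≤S (Γ′ ⇒ Δ′) = Γ ⊆ Γ′ × Δ I.⊑ Δ′

≤S-refl : ∀ {S} → S ≤S S
≤S-refl = F.⊑-refl , I.⊑-refl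

≤S-trans : ∀ {S T U} → S ≤S T → T ≤S U → S ≤S U
≤S-trans (Γ⊆ , Δ⊑) (Γ⊆′ , Δ⊑′) = F.⊑-trans Γ⊆ Γ⊆′ , I.⊑-trans Δ⊑ Δ⊑′

module S = Cover _≤S_ ≤S-refl ≤S-trans

_⊑_ : Hyp → Hyp → Set
_⊑_ = S._⊑_

map-fm⁺ : ∀ {Σ Σ′} → Σ ⊆ Σ′ → map fm Σ I.⊑ map fm Σ′
map-fm⁺ Σ⊆Σ′ x∈ with _ , A∈Σ , refl ← ∈-map⁻ fm x∈ = I.⊑-refl (∈-map⁺ fm (Σ⊆Σ′ A∈Σ))

≈I-refl : ∀ {x} → x ≈I x
≈I-refl {fm _}    = fm≈
≈I-refl {blk _ _} = blk≈ ↭-refl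

≈I-sym : ∀ {x y} → x ≈I y → y ≈I x
≈I-sym fm≈       = fm≈
≈I-sym (blk≈ p) = blk≈ (↭-sym p)

≈I⇒≤I : ∀ {x y} → x ≈I y → x ≤I y
≈I⇒≤I fm≈       = fm≤
≈I⇒≤I (blk≈ p) = blk≤ (F.↭⇒⊑ p)

↭⇒≈S : ∀ {Γ Γ′ Δ Δ′} → Γ ↭ Γ′ → Δ ↭ Δ′ → (Γ ⇒ Δ) ≈S (Γ′ ⇒ Δ′)
↭⇒≈S Γ↭Γ′ Δ↭Δ′ = Γ↭Γ′ , Perm.map (λ { refl → ≈I-refl }) (↭⇒↭ₛ Δ↭Δ′)

≈S-refl : ∀ {S} → S ≈S S
≈S-refl = ↭⇒≈S ↭-refl ↭-refl

≈S-sym : ∀ {S T} → S ≈S T → T ≈S S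
≈S-sym (Γ↭ , Δ≈) = ↭-sym Γ↭ , Perm.sym ≈I-sym Δ≈

≈S⇒≤S : ∀ {S T} → S ≈S T → S ≤S T
≈S⇒≤S (Γ↭ , Δ≈) = F.↭⇒⊑ Γ↭ , I.Permutation⇒⊑ (Perm.map ≈I⇒≤I Δ≈)

↭⇒≈H : ∀ {H H′} → H ↭ H′ → H ≈H H′
↭⇒≈H = Perm.map (λ { refl → ≈S-refl }) ∘ ↭⇒↭ₛ

≈H⇒⊑ : ∀ {H H′} → H ≈H H′ → H ⊑ H′
≈H⇒⊑ = S.Permutation⇒⊑ ∘ Perm.map ≈S⇒≤S

≈H⇒⊒ : ∀ {H H′} → H ≈H H′ → H′ ⊑ H
≈H⇒⊒ = ≈H⇒⊑ ∘ Perm.sym ≈S-sym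

-- Γ′ ⇒ Δ′ is a component of H′, up to ≈S, covering S; its shape is left open so that
-- the principal formulas of a rule can be brought to the front (reorder).
record Focus (S : Seq) (G H′ : Hyp) (Γ′ : List Fm) (Δ′ : List Item) : Set where
  field
    rest      : Hyp
    arranged  : H′ ≈H ((Γ′ ⇒ Δ′) ∷ rest)
    principal : S ≤S (Γ′ ⇒ Δ′)
    covered   : S ∷ G ⊑ (Γ′ ⇒ Δ′) ∷ rest

open Focus

focus : ∀ {S G H′} → S ∷ G ⊑ H′ → ∃₂ (Focus S G H′)
focus K =
  let T , T∈H′ , S≤T = find (K (here refl))
      rest , H′↭ = ∈⇒↭ T∈H′
  in Seq.ante T , Seq.succ T , record
       { rest = rest ; arranged = ↭⇒≈H H′↭ ; principal = S≤T
       ; covered = S.⊑-trans K (S.↭⇒⊑ H′↭) }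

reorder : ∀ {S G H′ Γ′ Δ′ Γ″ Δ″} → Focus S G H′ Γ′ Δ′ → Γ′ ↭ Γ″ → Δ′ ↭ Δ″ →
          Focus S G H′ Γ″ Δ″
reorder φ Γ′↭ Δ′↭ = record
  { rest      = rest φ
  ; arranged  = Perm.trans (arranged φ) (Perm.prep e (↭⇒≈H ↭-refl))
  ; principal = ≤S-trans (principal φ) (≈S⇒≤S e)
  ; covered   = S.⊑-trans (covered φ) (S.∷⁺ˡ (≈S⇒≤S e)) }
  where e = ↭⇒≈S Γ′↭ Δ′↭

focusAnte : ∀ {A Γ Δ G H′ Γ′ Δ′} → Focus (A ∷ Γ ⇒ Δ) G H′ Γ′ Δ′ →
            ∃ λ Γ″ → Focus (A ∷ Γ ⇒ Δ) G H′ (A ∷ Γ″) Δ′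
focusAnte φ =
  let Γ″ , Γ′↭ = ∈⇒↭ (proj₁ (principal φ) (here refl)) in Γ″ , reorder φ Γ′↭ ↭-refl

focusFm : ∀ {A Γ Δ G H′ Γ′ Δ′} → Focus (Γ ⇒ fm A ∷ Δ) G H′ Γ′ Δ′ →
          ∃ λ Δ″ → Focus (Γ ⇒ fm A ∷ Δ) G H′ Γ′ (fm A ∷ Δ″)
focusFm φ with _ , A∈Δ′ , fm≤ ← find (proj₂ (principal φ) (here refl)) =
  let Δ″ , Δ′↭ = ∈⇒↭ A∈Δ′ in Δ″ , reorder φ ↭-refl Δ′↭

focusBlk : ∀ {Σ C Γ Δ G H′ Γ′ Δ′} → Focus (Γ ⇒ blk Σ C ∷ Δ) G H′ Γ′ Δ′ →
           ∃₂ λ Σ′ Δ″ → Σ ⊆ Σ′ × Focus (Γ ⇒ blk Σ C ∷ Δ) G H′ Γ′ (blk Σ′ C ∷ Δ″)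
focusBlk φ with _ , B∈Δ′ , blk≤ Σ⊆Σ′ ← find (proj₂ (principal φ) (here refl)) =
  let Δ″ , Δ′↭ = ∈⇒↭ B∈Δ′ in _ , Δ″ , Σ⊆Σ′ , reorder φ ↭-refl Δ′↭

premiss⊑ : ∀ {S G H′ Γ′ Δ′ Sp Sp′} (φ : Focus S G H′ Γ′ Δ′) →
           (Γ′ ⇒ Δ′) ≤S Sp′ → Sp ≤S Sp′ → Sp ∷ G ⊑ Sp′ ∷ rest φ
premiss⊑ φ = S.replaceHead⁺ (covered φ)

-- copy adds the principal formula A ≼ B of A_L (to the antecedent) or A_R (to the succedent).
module _ (copy : Seq → Seq)
         (copy-mono : ∀ {T U} → T ≤S U → copy T ≤S copy U)
         (copy-infl : ∀ {T} → T ≤S copy T) where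

  copySecond : ∀ {S T G H′ Γ′ Δ′} (φ : Focus S (T ∷ G) H′ Γ′ Δ′) →
    (∀ {U} → U ≤S (Γ′ ⇒ Δ′) → copy U ≤S (Γ′ ⇒ Δ′)) →
    (S ∷ copy T ∷ G ⊑ H′)
    ⊎ ∃₂ λ U rest′ → H′ ≈H ((Γ′ ⇒ Δ′) ∷ U ∷ rest′)
                   × S ∷ copy T ∷ G ⊑ (Γ′ ⇒ Δ′) ∷ copy U ∷ rest′
  copySecond φ copy-absorb with covered φ (there (here refl))
  ... | here T≤S′ =
    inj₁ (S.⊑-trans (S.∈-∷⁺ʳ (here (principal φ))
                      (S.∈-∷⁺ʳ (here (copy-absorb T≤S′)) (covered φ ∘ there ∘ there)))
                    (≈H⇒⊒ (arranged φ)))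
  ... | there T≤rest =
    let U , U∈rest , T≤U = find T≤rest
        rest′ , rest↭ = ∈⇒↭ U∈rest
        grown = S.⊑-trans (S.↭⇒⊑ (prep _ rest↭)) (S.∷⁺ ≤S-refl (S.∷⁺ˡ copy-infl))
    in inj₂ (U , rest′ , Perm.trans (arranged φ) (Perm.prep ≈S-refl (↭⇒≈H rest↭))
            , S.∈-∷⁺ʳ (here (principal φ))
                (S.∈-∷⁺ʳ (there (here (copy-mono T≤U)))
                   (S.⊑-trans (covered φ ∘ there ∘ there) grown)))

data Lift (c : Calc) (ps : List Hyp) (H′ : Hyp) : Set where
  lifted   : ∀ {ps′ C′} → Rule c ps′ C′ → H′ ≈H C′ → Pointwise _⊑_ ps ps′ → Lift c ps H′
  absorbed : Any (_⊑ H′) ps → Lift c ps H′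

lift : ∀ {c ps C H′} → Rule c ps C → C ⊑ H′ → Lift c ps H′
lift init K =
  let _ , _ , φ = focus K ; _ , φ = focusAnte φ ; _ , φ = focusFm φ
  in lifted init (arranged φ) []
lift botL K =
  let _ , _ , φ = focus K ; _ , φ = focusAnte φ
  in lifted botL (arranged φ) []
lift impL K =
  let _ , _ , φ = focus K ; _ , φ = focusAnte φ ; Γ⊆ , Δ⊑ = principal φ
  in lifted impL (arranged φ)
       (premiss⊑ φ (F.x∷xs⊑x∷y∷xs , I.⊑-refl) (F.∷-∷⁺ Γ⊆ refl , Δ⊑)
       ∷ premiss⊑ φ (F.⊑-refl , I.xs⊑x∷xs) (Γ⊆ , I.∷⁺ fm≤ Δ⊑) ∷ [])
lift impR K =
  let _ , _ , φ = focus K ; _ , φ = focusFm φ ; Γ⊆ , Δ⊑ = principal φ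
  in lifted impR (arranged φ)
       (premiss⊑ φ (F.xs⊑x∷xs , I.x∷xs⊑x∷y∷xs) (F.∷⁺ refl Γ⊆ , I.∷-∷⁺ Δ⊑ fm≤) ∷ [])
lift precL K =
  let _ , _ , φ = focus K ; _ , φ = focusAnte φ ; _ , _ , Σ⊆ , φ = focusBlk φ
      Γ⊆ , Δ⊑ = principal φ
  in lifted precL (arranged φ)
       (premiss⊑ φ (F.⊑-refl , I.∷⁺ˡ (blk≤ F.xs⊑x∷xs))
                   (Γ⊆ , I.replaceHead⁺ Δ⊑ (blk≤ F.xs⊑x∷xs) (blk≤ (F.∷⁺ refl Σ⊆)))
       ∷ premiss⊑ φ (F.⊑-refl , I.x∷xs⊑x∷y∷xs) (Γ⊆ , I.∷-∷⁺ Δ⊑ (blk≤ Σ⊆)) ∷ [])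
lift precR K =
  let _ , _ , φ = focus K ; _ , φ = focusFm φ ; Γ⊆ , Δ⊑ = principal φ
  in lifted precR (arranged φ)
       (premiss⊑ φ (F.⊑-refl , I.x∷xs⊑x∷y∷xs) (Γ⊆ , I.∷-∷⁺ Δ⊑ ≤I-refl) ∷ [])
lift jp K =
  let _ , _ , φ = focus K ; _ , _ , Σ⊆ , φ = focusBlk φ
  in lifted jp (arranged φ) (S.∷-∷⁺ (covered φ) (F.⊑-refl , map-fm⁺ Σ⊆) ∷ [])
lift (ruleN h) K =
  let _ , _ , φ = focus K ; Γ⊆ , Δ⊑ = principal φ
  in lifted (ruleN h) (arranged φ)
       (premiss⊑ φ (F.⊑-refl , I.xs⊑x∷xs) (Γ⊆ , I.∷⁺ ≤I-refl Δ⊑) ∷ [])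
lift (ruleT h) K =
  let _ , _ , φ = focus K ; _ , φ = focusAnte φ ; Γ⊆ , Δ⊑ = principal φ
  in lifted (ruleT h) (arranged φ)
       (premiss⊑ φ (F.⊑-refl , I.xs⊑x∷xs) (Γ⊆ , I.∷⁺ fm≤ Δ⊑)
       ∷ premiss⊑ φ (F.⊑-refl , I.xs⊑x∷xs) (Γ⊆ , I.∷⁺ ≤I-refl Δ⊑) ∷ [])
lift (ruleW h) K =
  let _ , _ , φ = focus K ; _ , _ , Σ⊆ , φ = focusBlk φ ; Γ⊆ , Δ⊑ = principal φ
  in lifted (ruleW h) (arranged φ)
       (premiss⊑ φ (F.⊑-refl , I.∷-++⁺ {us = []} I.⊑-refl λ ())
                   (Γ⊆ , I.∷-++⁺ Δ⊑ (map-fm⁺ Σ⊆)) ∷ [])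
lift (ruleC h) K =
  let _ , _ , φ = focus K ; _ , φ = focusAnte φ ; Γ⊆ , Δ⊑ = principal φ
  in lifted (ruleC h) (arranged φ)
       (premiss⊑ φ (F.⊑-refl , I.xs⊑x∷xs) (Γ⊆ , I.∷⁺ fm≤ Δ⊑)
       ∷ premiss⊑ φ (F.x∷xs⊑x∷y∷xs , I.⊑-refl) (F.∷-∷⁺ Γ⊆ refl , Δ⊑) ∷ [])
lift (ruleAL {A = A} {B} h) K
  with copySecond (λ U → A ≼ B ∷ Seq.ante U ⇒ Seq.succ U)
         (λ (Γ⊆ , Δ⊑) → F.∷⁺ refl Γ⊆ , Δ⊑) (F.xs⊑x∷xs , I.⊑-refl)
         (proj₂ (focusAnte (proj₂ (proj₂ (focus K)))))
         (λ (Γ⊆ , Δ⊑) → F.∈-∷⁺ʳ (here refl) Γ⊆ , Δ⊑)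
... | inj₁ p⊑H′ = absorbed (here p⊑H′)
... | inj₂ (_ , _ , e , p⊑p′) = lifted (ruleAL h) e (p⊑p′ ∷ [])
lift (ruleAR {A = A} {B} h) K
  with copySecond (λ U → Seq.ante U ⇒ fm (A ≼ B) ∷ Seq.succ U)
         (λ (Γ⊆ , Δ⊑) → Γ⊆ , I.∷⁺ fm≤ Δ⊑) (F.⊑-refl , I.xs⊑x∷xs)
         (proj₂ (focusFm (proj₂ (proj₂ (focus K)))))
         (λ (Γ⊆ , Δ⊑) → Γ⊆ , I.∈-∷⁺ʳ (here fm≤) Δ⊑)
... | inj₁ p⊑H′ = absorbed (here p⊑H′)
... | inj₂ (_ , _ , e , p⊑p′) = lifted (ruleAR h) e (p⊑p′ ∷ [])

All-resp-Pointwise : ∀ {A : Set} {P : A → Set} {R : A → A → Set} →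
  (∀ {x y} → P x → R x y → P y) → ∀ {xs ys} → All P xs → Pointwise R xs ys → All P ys
All-resp-Pointwise resp []         []           = []
All-resp-Pointwise resp (px ∷ pxs) (xRy ∷ xsRys) = resp px xRy ∷ All-resp-Pointwise resp pxs xsRys

Der-suc : ∀ {c} n {H} → Der c n H → Der c (suc n) H
Der-suc (suc n) (der r e ds) = der r e (All.map (Der-suc n) ds)

Der-resp-⊑ : ∀ {c} n {H H′} → Der c n H → H ⊑ H′ → Der c n H′
Der-resp-⊑ (suc n) (der r e ds) K with lift r (S.⊑-trans (≈H⇒⊒ e) K)
... | lifted r′ e′ ps⊑ps′ = der r′ e′ (All-resp-Pointwise (Der-resp-⊑ n) ds ps⊑ps′)
... | absorbed p⊑H′ = let d , p⊑ = All.lookupAny ds p⊑H′ in Der-suc n (Der-resp-⊑ n d p⊑)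

conclusion⊑premisses : ∀ {c ps C} → Rule c ps C → All (C ⊑_) ps
conclusion⊑premisses init       = []
conclusion⊑premisses botL       = []
conclusion⊑premisses impL       =
  S.∷⁺ˡ (F.x∷xs⊑x∷y∷xs , I.⊑-refl) ∷ S.∷⁺ˡ (F.⊑-refl , I.xs⊑x∷xs) ∷ []
conclusion⊑premisses impR       = S.∷⁺ˡ (F.xs⊑x∷xs , I.x∷xs⊑x∷y∷xs) ∷ []
conclusion⊑premisses precL      =
  S.∷⁺ˡ (F.⊑-refl , I.∷⁺ˡ (blk≤ F.xs⊑x∷xs)) ∷ S.∷⁺ˡ (F.⊑-refl , I.x∷xs⊑x∷y∷xs) ∷ []
conclusion⊑premisses precR      = S.∷⁺ˡ (F.⊑-refl , I.x∷xs⊑x∷y∷xs) ∷ []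
conclusion⊑premisses jp         = S.x∷xs⊑x∷y∷xs ∷ []
conclusion⊑premisses (ruleN _)  = S.∷⁺ˡ (F.⊑-refl , I.xs⊑x∷xs) ∷ []
conclusion⊑premisses (ruleT _)  =
  S.∷⁺ˡ (F.⊑-refl , I.xs⊑x∷xs) ∷ S.∷⁺ˡ (F.⊑-refl , I.xs⊑x∷xs) ∷ []
conclusion⊑premisses (ruleW {Σ = Σ} _) =
  S.∷⁺ˡ (F.⊑-refl , I.∷-++⁺ {us = []} {vs = map fm Σ} I.⊑-refl λ ()) ∷ []
conclusion⊑premisses (ruleC _)  =
  S.∷⁺ˡ (F.⊑-refl , I.xs⊑x∷xs) ∷ S.∷⁺ˡ (F.x∷xs⊑x∷y∷xs , I.⊑-refl) ∷ []
conclusion⊑premisses (ruleAL _) = S.∷⁺ ≤S-refl (S.∷⁺ˡ (F.xs⊑x∷xs , I.⊑-refl)) ∷ []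
conclusion⊑premisses (ruleAR _) = S.∷⁺ ≤S-refl (S.∷⁺ˡ (F.⊑-refl , I.xs⊑x∷xs)) ∷ []

allRulesHPInvertible : ∀ c → AllRulesHPInvertible c
allRulesHPInvertible c r n d = All.map (Der-resp-⊑ n d) (conclusion⊑premisses r)

⊑⇒HPAdmissible : ∀ {c} R → (∀ {P C} → R P C → P ⊑ C) → HPAdmissible c R
⊑⇒HPAdmissible R P⊑C r n d = Der-resp-⊑ n d (P⊑C r)

lemma5p3 : (c : Calc) →
    AllRulesHPInvertible c
    × HPAdmissible c WkL × HPAdmissible c WkR × HPAdmissible c WkC
    × HPAdmissible c WkB × HPAdmissible c CtrL × HPAdmissible c CtrR
    × HPAdmissible c CtrC × HPAdmissible c CtrB
lemma5p3 c =
  allRulesHPInvertible c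
  , ⊑⇒HPAdmissible WkL (λ { wkL → S.∷⁺ˡ (F.xs⊑x∷xs , I.⊑-refl) })
  , ⊑⇒HPAdmissible WkR (λ { wkR → S.∷⁺ˡ (F.⊑-refl , I.xs⊑x∷xs) })
  , ⊑⇒HPAdmissible WkC (λ { wkC → S.xs⊑x∷xs })
  , ⊑⇒HPAdmissible WkB (λ { wkB → S.∷⁺ˡ (F.⊑-refl , I.∷⁺ˡ (blk≤ F.xs⊑x∷xs)) })
  , ⊑⇒HPAdmissible CtrL (λ { ctrL → S.∷⁺ˡ (F.x∷x∷xs⊑x∷xs , I.⊑-refl) })
  , ⊑⇒HPAdmissible CtrR (λ { ctrR → S.∷⁺ˡ (F.⊑-refl , I.x∷x∷xs⊑x∷xs) })
  , ⊑⇒HPAdmissible CtrC (λ { ctrC → S.x∷x∷xs⊑x∷xs })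
  , ⊑⇒HPAdmissible CtrB (λ { ctrB → S.∷⁺ˡ (F.⊑-refl , I.∷⁺ˡ (blk≤ F.x∷x∷xs⊑x∷xs)) })
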